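{- Let $T$ be a 1-point lattice tetrahedron with interior lattice point $w$, and write the barycentric coordinates of $w$ with respect to $T$ as $(d_1/N,d_2/N,d_3/N,d_4/N)$ with $d_1,\dots,d_4$ positive integers, $\sum_j d_j=N$, and $\gcd(d_j,N)=1$ for each $j$. Then for each $i$, writing $\{i,j,k,\ell\}=\{1,2,3,4\}$, $d_i$ divides at least one of $d_j+d_k$, $d_j+d_\ell$, $d_k+d_\ell$.
   Context: A lattice tetrahedron is a non-degenerate tetrahedron with vertices in $\mathbb{Z}^3$; it is clean if the only lattice points on its boundary are its vertices, and a 1-point lattice tetrahedron if it is clean with exactly one interior lattice point. Barycentric coordinates of $w$ with respect to $T=\mathrm{conv}(v_1,\dots,v_4)$ are the reals $\lambda_j$ with $w=\sum\lambda_jv_j$, $\sum\lambda_j=1$. (For a clean lattice tetrahedron, the barycentric coordinates of an interior lattice point always have this form.) -}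

module Defs where

open import Data.Nat as ℕ using (ℕ; suc)
open import Data.Integer as ℤ using (ℤ; +_; _+_; _-_; _*_)
open import Data.Fin using (Fin; zero; suc)
open import Data.Product using (Σ; _×_; ∃; ∃-syntax; _,_)
open import Relation.Binary.PropositionalEquality using (_≡_; _≢_)
open import Relation.Nullary using (¬_)

Point : Set
Point = Fin 3 → ℤ

_≈ₚ_ : Point → Point → Set
p ≈ₚ q = ∀ c → p c ≡ q c

Tetra : Set
Tetra = Fin 4 → Point

f0 f1 f2 f3 : Fin 4
f0 = zero
f1 = suc zero
f2 = suc (suc zero)
f3 = suc (suc (suc zero))

c0 c1 c2 : Fin 3
c0 = zero
c1 = suc zero
c2 = suc (suc zero)

sum4 : (Fin 4 → ℕ) → ℕ
sum4 a = a f0 ℕ.+ a f1 ℕ.+ a f2 ℕ.+ a f3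

comb : (Fin 4 → ℕ) → Tetra → Point
comb a v c = (+ a f0) * v f0 c + (+ a f1) * v f1 c + (+ a f2) * v f2 c + (+ a f3) * v f3 c

scale : ℕ → Point → Point
scale m p c = (+ m) * p c

det3 : Point → Point → Point → ℤ
det3 u v w =
  u c0 * (v c1 * w c2 - v c2 * w c1)
  - u c1 * (v c0 * w c2 - v c2 * w c0)
  + u c2 * (v c0 * w c1 - v c1 * w c0)

sub : Point → Point → Point
sub p q c = p c - q c

NonDegenerate : Tetra → Set
NonDegenerate v = det3 (sub (v f1) (v f0)) (sub (v f2) (v f0)) (sub (v f3) (v f0)) ≢ + 0

-- p = Σ λ_j v_j with λ_j = a_j / m, m = Σ a_j > 0, i.e. barycentric coordinates
-- of p (rational, written with common denominator m) are (a_j / m).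
HasBary : Tetra → Point → (Fin 4 → ℕ) → ℕ → Set
HasBary v p a m = (0 ℕ.< m) × (sum4 a ≡ m) × (scale m p ≈ₚ comb a v)

InTetra : Tetra → Point → Set
InTetra v p = ∃[ a ] ∃[ m ] HasBary v p a m

OnBoundary : Tetra → Point → Set
OnBoundary v p = ∃[ a ] ∃[ m ] (HasBary v p a m × ∃[ j ] a j ≡ 0)

Interior : Tetra → Point → Set
Interior v p = ∃[ a ] ∃[ m ] (HasBary v p a m × (∀ j → 0 ℕ.< a j))

IsVertex : Tetra → Point → Set
IsVertex v p = ∃[ j ] (p ≈ₚ v j)

Clean : Tetra → Set
Clean v = ∀ p → OnBoundary v p → IsVertex v p

OnePointWith : Tetra → Point → Set
OnePointWith v w =
  NonDegenerate v × Clean v × Interior v w × (∀ p → Interior v p → p ≈ₚ w)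

-- Write r k j = k dⱼ mod N and σ k = Σⱼ r k j, a multiple of N. For 0 < k < N the lattice point
-- k w − Σⱼ ⌊k dⱼ / N⌋ vⱼ has barycentric coordinates r k j / N, all positive; if σ k = N it is an
-- interior point, hence w, and then k = 1. So σ k = 2N for 1 < k < N − 1, and since passing from k
-- to k + 1 changes σ by N minus N times the number of coordinates that wrap past N, exactly one
-- coordinate wraps at each step 1 < k < N − 2. At k ≡ dᵢ⁻¹ the wrapping coordinate l gives
-- dᵢ τ + dₗ ≡ 0 (mod N) with 0 < τ ≤ dₗ, and any multiple beyond N would produce a step with two
-- wraps; so dᵢ τ + dₗ = N and dᵢ divides the sum of the remaining two. When N = 2dᵢ + 1 this inverse
-- is −2 and the argument fails; instead no other coordinate wraps at even steps, which forces
-- 2dⱼ ∣ N + 1 for every other dⱼ ≥ 2, so these divide dᵢ + 1, their sum. Three such numbers would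
-- have one dividing another, again giving two wraps at one step, so some other dⱼ equals 1.

module Submission where

open import Defs
open import Data.Fin using (Fin; zero; suc)
open import Data.Product using (_×_; _,_; ∃; ∃-syntax; proj₁; proj₂; map₂)
open import Data.Sum using (_⊎_; inj₁; inj₂; [_,_]′)
open import Data.Empty using (⊥; ⊥-elim)
open import Function using (_∘_; id)
open import Relation.Nullary using (¬_; contradiction; Dec; yes; no)
open import Relation.Binary.PropositionalEquality

module Barycentric where

  import Data.Nat as ℕ
  open import Data.Integer using (ℤ; +_; 0ℤ; _+_; _-_; _*_)
  open import Data.Integer.Properties using (pos-+; pos-*; +-injective; i*j≡0⇒i≡0∨j≡0; i-j≡0⇒i≡j)
  open import Data.Integer.Tactic.RingSolver using (solve-∀)

  private
    pos-sum4 : ∀ (a : Fin 4 → ℕ.ℕ) → + sum4 a ≡ + a f0 + + a f1 + + a f2 + + a f3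
    pos-sum4 a = trans (pos-+ (a f0 ℕ.+ a f1 ℕ.+ a f2) (a f3))
      (cong (_+ + a f3) (trans (pos-+ (a f0 ℕ.+ a f1) (a f2)) (cong (_+ + a f2) (pos-+ (a f0) (a f1)))))

    edge-expansion : ∀ a₀ a₁ a₂ a₃ b₀ b₁ b₂ b₃ v₀ v₁ v₂ v₃ →
      (a₁ - b₁) * (v₁ - v₀) + (a₂ - b₂) * (v₂ - v₀) + (a₃ - b₃) * (v₃ - v₀)
      ≡ ((a₀ * v₀ + a₁ * v₁ + a₂ * v₂ + a₃ * v₃) - (b₀ * v₀ + b₁ * v₁ + b₂ * v₂ + b₃ * v₃))
        - ((a₀ + a₁ + a₂ + a₃) - (b₀ + b₁ + b₂ + b₃)) * v₀
    edge-expansion = solve-∀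

    cancel : ∀ s t u → (s - s) - (t - t) * u ≡ 0ℤ
    cancel = solve-∀

    det3-linearˡ : ∀ e₁ e₂ e₃ (u₁ u₂ u₃ : Point) →
      e₁ * det3 u₁ u₂ u₃ ≡ det3 (λ c → e₁ * u₁ c + e₂ * u₂ c + e₃ * u₃ c) u₂ u₃
    det3-linearˡ e₁ e₂ e₃ u₁ u₂ u₃ = lemma e₁ e₂ e₃ (u₁ c0) (u₁ c1) (u₁ c2) (u₂ c0) (u₂ c1) (u₂ c2) (u₃ c0) (u₃ c1) (u₃ c2)
      where
        lemma : ∀ e₁ e₂ e₃ a₀ a₁ a₂ b₀ b₁ b₂ c₀ c₁ c₂ →
          e₁ * (a₀ * (b₁ * c₂ - b₂ * c₁) - a₁ * (b₀ * c₂ - b₂ * c₀) + a₂ * (b₀ * c₁ - b₁ * c₀))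
          ≡ (e₁ * a₀ + e₂ * b₀ + e₃ * c₀) * (b₁ * c₂ - b₂ * c₁)
            - (e₁ * a₁ + e₂ * b₁ + e₃ * c₁) * (b₀ * c₂ - b₂ * c₀)
            + (e₁ * a₂ + e₂ * b₂ + e₃ * c₂) * (b₀ * c₁ - b₁ * c₀)
        lemma = solve-∀

    det3-zeroˡ : ∀ (x u₂ u₃ : Point) → (∀ c → x c ≡ 0ℤ) → det3 x u₂ u₃ ≡ 0ℤ
    det3-zeroˡ x u₂ u₃ x≡0 rewrite x≡0 c0 | x≡0 c1 | x≡0 c2 = lemma (u₂ c0) (u₂ c1) (u₂ c2) (u₃ c0) (u₃ c1) (u₃ c2)
      where
        lemma : ∀ a₀ a₁ a₂ b₀ b₁ b₂ →
          0ℤ * (a₁ * b₂ - a₂ * b₁) - 0ℤ * (a₀ * b₂ - a₂ * b₀) + 0ℤ * (a₀ * b₁ - a₁ * b₀) ≡ 0ℤ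
        lemma = solve-∀

  barycentric-unique₁ : ∀ {v : Tetra} {a b : Fin 4 → ℕ.ℕ} → NonDegenerate v →
    comb a v ≈ₚ comb b v → sum4 a ≡ sum4 b → a f1 ≡ b f1
  barycentric-unique₁ {v} {a} {b} nondeg same-point same-sum =
    +-injective (i-j≡0⇒i≡j (+ a f1) (+ b f1) e₁≡0)
    where
      e : Fin 4 → ℤ
      e j = + a j - + b j
      u : Fin 4 → Point
      u j = sub (v j) (v f0)
      displacement≡0 : ∀ c → e f1 * u f1 c + e f2 * u f2 c + e f3 * u f3 c ≡ 0ℤ
      displacement≡0 c =
        trans (edge-expansion (+ a f0) (+ a f1) (+ a f2) (+ a f3) (+ b f0) (+ b f1) (+ b f2) (+ b f3)
                              (v f0 c) (v f1 c) (v f2 c) (v f3 c))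
          (trans (cong₂ (λ s t → (s - comb b v c) - (t - (+ b f0 + + b f1 + + b f2 + + b f3)) * v f0 c)
                        (same-point c)
                        (trans (sym (pos-sum4 a)) (trans (cong +_ same-sum) (pos-sum4 b))))
                 (cancel (comb b v c) (+ b f0 + + b f1 + + b f2 + + b f3) (v f0 c)))
      x : Point
      x c = e f1 * u f1 c + e f2 * u f2 c + e f3 * u f3 c
      e₁det≡0 : e f1 * det3 (u f1) (u f2) (u f3) ≡ 0ℤ
      e₁det≡0 = trans (det3-linearˡ (e f1) (e f2) (e f3) (u f1) (u f2) (u f3)) (det3-zeroˡ x (u f2) (u f3) displacement≡0)
      e₁≡0 : e f1 ≡ 0ℤ
      e₁≡0 = [ id , (λ det≡0 → contradiction det≡0 nondeg) ]′ (i*j≡0⇒i≡0∨j≡0 (e f1) e₁det≡0)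

  translate : ℕ.ℕ → (Fin 4 → ℕ.ℕ) → Tetra → Point → Point
  translate k q v w c = + k * w c - comb q v c

  translate-barycentric : ∀ {v w N k} {d q r : Fin 4 → ℕ.ℕ} → scale N w ≈ₚ comb d v →
    (∀ j → k ℕ.* d j ≡ r j ℕ.+ q j ℕ.* N) → scale N (translate k q v w) ≈ₚ comb r v
  translate-barycentric {v} {w} {N} {k} {d} {q} {r} Nw≡ kd≡ c = begin
    + N * (+ k * w c - comb q v c)              ≡⟨ distrib (+ k) (+ N) (w c) (comb q v c) ⟩
    + k * (+ N * w c) - + N * comb q v c        ≡⟨ cong (λ x → + k * x - + N * comb q v c) (Nw≡ c) ⟩
    + k * comb d v c - + N * comb q v c         ≡⟨ collect (+ k) (+ N) (+ d f0) (+ d f1) (+ d f2) (+ d f3)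
                                                     (+ q f0) (+ q f1) (+ q f2) (+ q f3)
                                                     (v f0 c) (v f1 c) (v f2 c) (v f3 c) ⟩
    coeff f0 * v f0 c + coeff f1 * v f1 c + coeff f2 * v f2 c + coeff f3 * v f3 c
      ≡⟨ cong₂ _+_ (cong₂ _+_ (cong₂ _+_ (term f0) (term f1)) (term f2)) (term f3) ⟩
    comb r v c                                  ∎
    where
      open ≡-Reasoning
      coeff : Fin 4 → ℤ
      coeff j = + k * + d j - + q j * + N
      coeff≡r : ∀ j → coeff j ≡ + r j
      coeff≡r j = begin
        + k * + d j - + q j * + N         ≡⟨ cong₂ _-_ (sym (pos-* k (d j))) (sym (pos-* (q j) N)) ⟩
        + (k ℕ.* d j) - + (q j ℕ.* N)     ≡⟨ cong (λ x → + x - + (q j ℕ.* N)) (kd≡ j) ⟩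
        + (r j ℕ.+ q j ℕ.* N) - + (q j ℕ.* N) ≡⟨ cong (_- + (q j ℕ.* N)) (pos-+ (r j) (q j ℕ.* N)) ⟩
        + r j + + (q j ℕ.* N) - + (q j ℕ.* N) ≡⟨ add-sub (+ r j) (+ (q j ℕ.* N)) ⟩
        + r j                             ∎
        where
          add-sub : ∀ x y → x + y - y ≡ x
          add-sub = solve-∀
      term : ∀ j → coeff j * v j c ≡ + r j * v j c
      term j = cong (_* v j c) (coeff≡r j)
      distrib : ∀ k n x y → n * (k * x - y) ≡ k * (n * x) - n * y
      distrib = solve-∀
      collect : ∀ k n d₀ d₁ d₂ d₃ q₀ q₁ q₂ q₃ v₀ v₁ v₂ v₃ →
        k * (d₀ * v₀ + d₁ * v₁ + d₂ * v₂ + d₃ * v₃) - n * (q₀ * v₀ + q₁ * v₁ + q₂ * v₂ + q₃ * v₃)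
        ≡ (k * d₀ - q₀ * n) * v₀ + (k * d₁ - q₁ * n) * v₁ + (k * d₂ - q₂ * n) * v₂ + (k * d₃ - q₃ * n) * v₃
      collect = solve-∀

open Barycentric using (barycentric-unique₁; translate; translate-barycentric)

open import Data.Nat
open import Data.Nat.Properties
open import Algebra.Properties.CommutativeSemigroup +-commutativeSemigroup using (interchange)
open import Data.Nat.Divisibility
open import Data.Nat.DivMod
open import Data.Nat.GCD using (gcd; module Bézout)
open import Data.Nat.Coprimality using (Coprime; coprime-divisor; coprime-Bézout; gcd≡1⇒coprime) renaming (sym to ⊥-sym)
open import Data.Nat.Tactic.RingSolver using (solve-∀)
import Data.Integer as ℤ

-- Sums over the four vertices

record Complement (i l : Fin 4) : Set where
  constructor complementOf
  field
    j k : Fin 4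
    j≢i : j ≢ i
    k≢i : k ≢ i
    j≢l : j ≢ l
    k≢l : k ≢ l
    j≢k : j ≢ k
    sum4-split : ∀ f → sum4 f ≡ (f i + f l) + (f j + f k)

module _ (f : Fin 4 → ℕ) where

  sum4-split₀₁ : sum4 f ≡ (f f0 + f f1) + (f f2 + f f3)
  sum4-split₀₁ = +-assoc (f f0 + f f1) (f f2) (f f3)

  sum4-split₀₂ : sum4 f ≡ (f f0 + f f2) + (f f1 + f f3)
  sum4-split₀₂ = trans sum4-split₀₁ (interchange (f f0) (f f1) (f f2) (f f3))

  sum4-split₀₃ : sum4 f ≡ (f f0 + f f3) + (f f1 + f f2)
  sum4-split₀₃ = trans sum4-split₀₁
    (trans (cong (f f0 + f f1 +_) (+-comm (f f2) (f f3))) (interchange (f f0) (f f1) (f f3) (f f2)))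

private
  swapˡ : ∀ {m} a b {c} → m ≡ (a + b) + c → m ≡ (b + a) + c
  swapˡ a b {c} e = trans e (cong (_+ c) (+-comm a b))

  swap : ∀ {m} a b → m ≡ a + b → m ≡ b + a
  swap a b e = trans e (+-comm a b)

complement : ∀ i l → l ≢ i → Complement i l
complement zero zero l≢i = contradiction refl l≢i
complement zero (suc zero) _ =
  complementOf f2 f3 (λ ()) (λ ()) (λ ()) (λ ()) (λ ()) sum4-split₀₁
complement zero (suc (suc zero)) _ =
  complementOf f1 f3 (λ ()) (λ ()) (λ ()) (λ ()) (λ ()) sum4-split₀₂
complement zero (suc (suc (suc zero))) _ =
  complementOf f1 f2 (λ ()) (λ ()) (λ ()) (λ ()) (λ ()) sum4-split₀₃
complement (suc zero) zero _ =
  complementOf f2 f3 (λ ()) (λ ()) (λ ()) (λ ()) (λ ()) (λ f → swapˡ (f f0) (f f1) (sum4-split₀₁ f))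
complement (suc zero) (suc zero) l≢i = contradiction refl l≢i
complement (suc zero) (suc (suc zero)) _ =
  complementOf f0 f3 (λ ()) (λ ()) (λ ()) (λ ()) (λ ()) (λ f → swap (f f0 + f f3) (f f1 + f f2) (sum4-split₀₃ f))
complement (suc zero) (suc (suc (suc zero))) _ =
  complementOf f0 f2 (λ ()) (λ ()) (λ ()) (λ ()) (λ ()) (λ f → swap (f f0 + f f2) (f f1 + f f3) (sum4-split₀₂ f))
complement (suc (suc zero)) zero _ =
  complementOf f1 f3 (λ ()) (λ ()) (λ ()) (λ ()) (λ ()) (λ f → swapˡ (f f0) (f f2) (sum4-split₀₂ f))
complement (suc (suc zero)) (suc zero) _ =
  complementOf f0 f3 (λ ()) (λ ()) (λ ()) (λ ()) (λ ()) (λ f → swapˡ (f f1) (f f2) (swap (f f0 + f f3) (f f1 + f f2) (sum4-split₀₃ f)))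
complement (suc (suc zero)) (suc (suc zero)) l≢i = contradiction refl l≢i
complement (suc (suc zero)) (suc (suc (suc zero))) _ =
  complementOf f0 f1 (λ ()) (λ ()) (λ ()) (λ ()) (λ ()) (λ f → swap (f f0 + f f1) (f f2 + f f3) (sum4-split₀₁ f))
complement (suc (suc (suc zero))) zero _ =
  complementOf f1 f2 (λ ()) (λ ()) (λ ()) (λ ()) (λ ()) (λ f → swapˡ (f f0) (f f3) (sum4-split₀₃ f))
complement (suc (suc (suc zero))) (suc zero) _ =
  complementOf f0 f2 (λ ()) (λ ()) (λ ()) (λ ()) (λ ()) (λ f → swapˡ (f f1) (f f3) (swap (f f0 + f f2) (f f1 + f f3) (sum4-split₀₂ f)))
complement (suc (suc (suc zero))) (suc (suc zero)) _ =
  complementOf f0 f1 (λ ()) (λ ()) (λ ()) (λ ()) (λ ()) (λ f → swapˡ (f f2) (f f3) (swap (f f0 + f f1) (f f2 + f f3) (sum4-split₀₁ f)))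
complement (suc (suc (suc zero))) (suc (suc (suc zero))) l≢i = contradiction refl l≢i

another : ∀ (i : Fin 4) → ∃[ l ] l ≢ i
another zero = f1 , λ ()
another (suc _) = f0 , λ ()

pair≤sum4 : ∀ (f : Fin 4 → ℕ) {a b} → b ≢ a → f a + f b ≤ sum4 f
pair≤sum4 f {a} {b} b≢a = begin
  f a + f b                 ≤⟨ m≤m+n (f a + f b) _ ⟩
  f a + f b + (f j + f k)   ≡⟨ sym (sum4-split f) ⟩
  sum4 f                    ∎
  where
    open ≤-Reasoning
    open Complement (complement a b b≢a)

sum4-pos⇒pos : ∀ (f : Fin 4 → ℕ) → 0 < sum4 f → ∃[ j ] 0 < f j
sum4-pos⇒pos f sum>0 with f f0 in e0 | f f1 in e1 | f f2 in e2 | f f3 in e3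
... | suc _ | _ | _ | _ = f0 , subst (0 <_) (sym e0) z<s
... | 0 | suc _ | _ | _ = f1 , subst (0 <_) (sym e1) z<s
... | 0 | 0 | suc _ | _ = f2 , subst (0 <_) (sym e2) z<s
... | 0 | 0 | 0 | suc _ = f3 , subst (0 <_) (sym e3) z<s
... | 0 | 0 | 0 | 0 = contradiction sum>0 (<-irrefl refl)

sum4-+ : ∀ (f g : Fin 4 → ℕ) → sum4 (λ j → f j + g j) ≡ sum4 f + sum4 g
sum4-+ f g = lemma (f f0) (f f1) (f f2) (f f3) (g f0) (g f1) (g f2) (g f3)
  where
    lemma : ∀ a₀ a₁ a₂ a₃ b₀ b₁ b₂ b₃ →
      (a₀ + b₀) + (a₁ + b₁) + (a₂ + b₂) + (a₃ + b₃) ≡ (a₀ + a₁ + a₂ + a₃) + (b₀ + b₁ + b₂ + b₃)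
    lemma = solve-∀

sum4-*ˡ : ∀ k (f : Fin 4 → ℕ) → sum4 (λ j → k * f j) ≡ k * sum4 f
sum4-*ˡ k f = sym (lemma k (f f0) (f f1) (f f2) (f f3))
  where
    lemma : ∀ k a₀ a₁ a₂ a₃ → k * (a₀ + a₁ + a₂ + a₃) ≡ k * a₀ + k * a₁ + k * a₂ + k * a₃
    lemma = solve-∀

sum4-*ʳ : ∀ (f : Fin 4 → ℕ) n → sum4 (λ j → f j * n) ≡ sum4 f * n
sum4-*ʳ f n = sym (lemma (f f0) (f f1) (f f2) (f f3) n)
  where
    lemma : ∀ a₀ a₁ a₂ a₃ n → (a₀ + a₁ + a₂ + a₃) * n ≡ a₀ * n + a₁ * n + a₂ * n + a₃ * n
    lemma = solve-∀

sum4-cong : ∀ {f g : Fin 4 → ℕ} → (∀ j → f j ≡ g j) → sum4 f ≡ sum4 g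
sum4-cong f≡g = cong₂ _+_ (cong₂ _+_ (cong₂ _+_ (f≡g f0) (f≡g f1)) (f≡g f2)) (f≡g f3)

sum4-const : ∀ n → sum4 (λ _ → n) ≡ 4 * n
sum4-const = lemma
  where
    lemma : ∀ n → n + n + n + n ≡ 4 * n
    lemma = solve-∀

≤sum4 : ∀ (f : Fin 4 → ℕ) a → f a ≤ sum4 f
≤sum4 f a = ≤-trans (m≤m+n (f a) (f l)) (pair≤sum4 f l≢a)
  where
    l = proj₁ (another a)
    l≢a = proj₂ (another a)

m+n≡o+p⇒m≡o∸n+p : ∀ {m n o p} → n ≤ o → m + n ≡ o + p → m ≡ o ∸ n + p
m+n≡o+p⇒m≡o∸n+p {m} {n} {o} {p} n≤o m+n≡o+p = +-cancelʳ-≡ n m (o ∸ n + p) (begin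
  m + n               ≡⟨ m+n≡o+p ⟩
  o + p               ≡⟨ cong (_+ p) (m∸n+n≡m n≤o) ⟨
  o ∸ n + n + p       ≡⟨ +-assoc (o ∸ n) n p ⟩
  o ∸ n + (n + p)     ≡⟨ cong (o ∸ n +_) (+-comm n p) ⟩
  o ∸ n + (p + n)     ≡⟨ +-assoc (o ∸ n) p n ⟨
  o ∸ n + p + n       ∎)
  where open ≡-Reasoning

division-with-positive-remainder : ∀ {M τ} → 0 < τ → 0 < M → ∃[ m ] ∃[ δ ] (m * τ + δ ≡ M × 0 < δ × δ ≤ τ)
division-with-positive-remainder {M} {τ@(suc _)} _ M>0 = X / τ , suc (X % τ) , (begin
  X / τ * τ + suc (X % τ)   ≡⟨ +-suc (X / τ * τ) (X % τ) ⟩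
  suc (X / τ * τ + X % τ)   ≡⟨ cong suc (+-comm (X / τ * τ) (X % τ)) ⟩
  suc (X % τ + X / τ * τ)   ≡⟨ cong suc (m≡m%n+[m/n]*n X τ) ⟨
  suc X                     ≡⟨ suc-pred M {{>-nonZero M>0}} ⟩
  M                         ∎) , z<s , m%n<n X τ
  where
    open ≡-Reasoning
    X = pred M

complement-product : ∀ A B m τ {n} → A + m ≡ n → B + τ ≡ n → A * B + (m + τ) * n ≡ m * τ + n * n
complement-product A B m τ {n} A+m≡n B+τ≡n = begin
  A * B + (m + τ) * n                    ≡⟨ cong (A * B +_) (*-distribʳ-+ n m τ) ⟩
  A * B + (m * n + τ * n)                ≡⟨ cong₂ (λ x y → A * B + (m * x + τ * y)) (sym B+τ≡n) (sym A+m≡n) ⟩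
  A * B + (m * (B + τ) + τ * (A + m))    ≡⟨ expand A B m τ ⟩
  m * τ + (A + m) * (B + τ)              ≡⟨ cong₂ (λ x y → m * τ + x * y) A+m≡n B+τ≡n ⟩
  m * τ + n * n                          ∎
  where
    open ≡-Reasoning
    expand : ∀ A B m τ → A * B + (m * (B + τ) + τ * (A + m)) ≡ m * τ + (A + m) * (B + τ)
    expand = solve-∀

even-or-odd : ∀ n → ∃[ a ] (n ≡ 2 * a ⊎ n ≡ suc (2 * a))
even-or-odd 0 = 0 , inj₁ refl
even-or-odd (suc n) with even-or-odd n
... | a , inj₁ n≡2a = a , inj₂ (cong suc n≡2a)
... | a , inj₂ n≡2a+1 = suc a , inj₁ (trans (cong suc n≡2a+1) (sym (*-suc 2 a)))

largest-of-three : ∀ x y z → (x ≤ z × y ≤ z) ⊎ (y ≤ x × z ≤ x) ⊎ (x ≤ y × z ≤ y)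
largest-of-three x y z with ≤-total x z | ≤-total y z | ≤-total y x
... | inj₁ x≤z | inj₁ y≤z | _ = inj₁ (x≤z , y≤z)
... | inj₁ x≤z | inj₂ z≤y | _ = inj₂ (inj₂ (≤-trans x≤z z≤y , z≤y))
... | inj₂ z≤x | _ | inj₁ y≤x = inj₂ (inj₁ (y≤x , z≤x))
... | inj₂ z≤x | _ | inj₂ x≤y = inj₂ (inj₂ (x≤y , ≤-trans z≤x x≤y))

module _ {N D a ε m δ : ℕ} (excess : 2 * suc a * D ≡ N + ε) (mε+δ≡D : m * ε + δ ≡ D) where

  private
    total : suc (suc (2 * (a + m * suc a))) * D ≡ suc m * (N + ε)
    total = trans (expand a m D) (cong (suc m *_) excess)
      where
        expand : ∀ a m d → suc (suc (2 * (a + m * suc a))) * d ≡ suc m * (2 * suc a * d)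
        expand = solve-∀

  excess-identity : ε ≤ D + δ → 2 * (a + m * suc a) * D + (D + δ ∸ ε) ≡ suc m * N
  excess-identity ε≤D+δ = +-cancelʳ-≡ ε (κ * D + (D + δ ∸ ε)) (suc m * N) (begin
    κ * D + (D + δ ∸ ε) + ε       ≡⟨ +-assoc (κ * D) (D + δ ∸ ε) ε ⟩
    κ * D + (D + δ ∸ ε + ε)       ≡⟨ cong (κ * D +_) (m∸n+n≡m ε≤D+δ) ⟩
    κ * D + (D + δ)               ≡⟨ +-assoc (κ * D) D δ ⟨
    κ * D + D + δ                 ≡⟨ +-cancelʳ-≡ (m * ε) (κ * D + D + δ) (N + m * N + ε) (begin
      κ * D + D + δ + m * ε         ≡⟨ +-assoc (κ * D + D) δ (m * ε) ⟩
      κ * D + D + (δ + m * ε)       ≡⟨ cong (κ * D + D +_) (trans (+-comm δ (m * ε)) mε+δ≡D) ⟩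
      κ * D + D + D                 ≡⟨ reorder (κ * D) D ⟩
      suc (suc κ) * D               ≡⟨ total ⟩
      suc m * (N + ε)               ≡⟨ distribute m N ε ⟩
      N + m * N + ε + m * ε         ∎) ⟩
    N + m * N + ε                 ∎)
    where
      open ≡-Reasoning
      κ = 2 * (a + m * suc a)
      reorder : ∀ x y → x + y + y ≡ y + (y + x)
      reorder = solve-∀
      distribute : ∀ m n e → suc m * (n + e) ≡ n + m * n + e + m * e
      distribute = solve-∀

  excess-range : 0 < δ → δ ≤ ε → 2 ≤ ε → ε < D → 2 * D < N → 0 < m × suc (2 * (a + m * suc a)) < N
  excess-range δ>0 δ≤ε ε≥2 ε<D 2D<N = m>0 , <-trans (n<1+n _) (*-cancelʳ-< D _ N (begin-strict
    suc (suc (2 * (a + m * suc a))) * D   ≡⟨ total ⟩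
    suc m * (N + ε)                       ≡⟨ *-distribˡ-+ (suc m) N ε ⟩
    suc m * N + suc m * ε                 <⟨ +-monoʳ-< (suc m * N) sm-ε<N ⟩
    suc m * N + N                         ≡⟨ +-comm (suc m * N) N ⟩
    suc (suc m) * N                       ≤⟨ *-monoˡ-≤ N sm<D ⟩
    D * N                                 ≡⟨ *-comm D N ⟩
    N * D                                 ∎))
    where
      open ≤-Reasoning
      mε<D : m * ε < D
      mε<D = <-≤-trans (m<m+n (m * ε) δ>0) (≤-reflexive mε+δ≡D)
      m>0 : 0 < m
      m>0 = n≢0⇒n>0 λ m≡0 → <⇒≱ ε<D
        (≤-trans (≤-reflexive (sym (trans (cong (λ x → x * ε + δ) (sym m≡0)) mε+δ≡D))) δ≤ε)
      sm-ε<N : suc m * ε < N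
      sm-ε<N = begin-strict
        ε + m * ε     ≤⟨ +-monoʳ-≤ ε (<⇒≤ mε<D) ⟩
        ε + D         <⟨ +-monoˡ-< D ε<D ⟩
        D + D         ≡⟨ cong (D +_) (+-identityʳ D) ⟨
        2 * D         <⟨ 2D<N ⟩
        N             ∎
      sm<D : suc m < D
      sm<D = begin-strict
        suc m         ≡⟨ +-comm 1 m ⟩
        m + 1         ≤⟨ +-monoʳ-≤ m m>0 ⟩
        m + m         ≡⟨ trans (*-comm m 2) (cong (m +_) (+-identityʳ m)) ⟨
        m * 2         ≤⟨ *-monoʳ-≤ m ε≥2 ⟩
        m * ε         <⟨ mε<D ⟩
        D             ∎

factor<n : ∀ {s d n} → 2 ≤ s → 2 ≤ d → s * d ≡ suc n → s < n
factor<n {s} {d} {n} s≥2 d≥2 sd≡n+1 = ≤-pred (≤-trans (≤-reflexive (+-comm 2 s)) (begin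
  s + 2          ≤⟨ +-monoʳ-≤ s s≥2 ⟩
  s + s          ≡⟨ trans (*-comm s 2) (cong (s +_) (+-identityʳ s)) ⟨
  s * 2          ≤⟨ *-monoʳ-≤ s d≥2 ⟩
  s * d          ≡⟨ sd≡n+1 ⟩
  suc n          ∎))
  where open ≤-Reasoning

factor-< : ∀ {m q} n k → m ≡ q * n → m < k * n → q < k
factor-< {m} {q} n k refl m<kn = *-cancelʳ-< n q k m<kn

factor-pos : ∀ {m q} n → m ≡ q * n → 0 < m → 0 < q
factor-pos {q = zero} n refl ()
factor-pos {q = suc _} n _ _ = z<s

divides-double⇒divides : ∀ {x y} → 0 < x → x ≤ y → y ∣ 2 * x → x ∣ y
divides-double⇒divides {x} {y} x>0 x≤y (divides q 2x≡qy) =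
  by-quotient q 2x≡qy (factor-pos y 2x≡qy (*-monoʳ-< 2 x>0))
    (factor-< y 3 2x≡qy (≤-<-trans (*-monoʳ-≤ 2 x≤y) (*-monoˡ-< y {{>-nonZero (<-≤-trans x>0 x≤y)}} {2} {3} ≤-refl)))
  where
    by-quotient : ∀ q → 2 * x ≡ q * y → 0 < q → q < 3 → x ∣ y
    by-quotient 1 2x≡y _ _ = divides 2 (sym (trans 2x≡y (+-identityʳ y)))
    by-quotient 2 2x≡2y _ _ = ∣-reflexive (*-cancelˡ-≡ x y 2 2x≡2y)
    by-quotient (suc (suc (suc _))) _ _ (s≤s (s≤s (s≤s ())))

divisor-among-three : ∀ {x y z} → 0 < x → 0 < y → x ≤ z → y ≤ z →
  x ∣ x + y + z → y ∣ x + y + z → z ∣ x + y + z → x ∣ z ⊎ x ∣ y ⊎ y ∣ x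
divisor-among-three {x} {y} {z} x>0 y>0 x≤z y≤z x∣s y∣s z∣s
  with ∣m+n∣m⇒∣n (subst (z ∣_) (+-comm (x + y) z) z∣s) ∣-refl
... | divides q x+y≡qz = by-quotient q x+y≡qz
        (factor-pos z x+y≡qz (<-≤-trans x>0 (m≤m+n x y)))
        (factor-< z 3 x+y≡qz (≤-<-trans (+-mono-≤ x≤z (≤-trans y≤z (m≤m+n z 0)))
                                         (*-monoˡ-< z {{>-nonZero (<-≤-trans x>0 x≤z)}} {2} {3} ≤-refl)))
  where
    twice : z ≡ x + y → x + y + z ≡ 2 * x + 2 * y
    twice z≡x+y = trans (cong (x + y +_) z≡x+y) (sum-twice x y)
      where
        sum-twice : ∀ a b → a + b + (a + b) ≡ 2 * a + 2 * b
        sum-twice = solve-∀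
    by-quotient : ∀ q → x + y ≡ q * z → 0 < q → q < 3 → x ∣ z ⊎ x ∣ y ⊎ y ∣ x
    by-quotient 1 x+y≡z _ _ with ≤-total x y
    ... | inj₁ x≤y = inj₂ (inj₁ (divides-double⇒divides x>0 x≤y
                      (∣m+n∣m⇒∣n (subst (y ∣_) (trans (twice z≡x+y) (+-comm (2 * x) (2 * y))) y∣s) (n∣m*n 2))))
      where z≡x+y = sym (trans x+y≡z (+-identityʳ z))
    ... | inj₂ y≤x = inj₂ (inj₂ (divides-double⇒divides y>0 y≤x
                      (∣m+n∣m⇒∣n (subst (x ∣_) (twice z≡x+y) x∣s) (n∣m*n 2))))
      where z≡x+y = sym (trans x+y≡z (+-identityʳ z))
    by-quotient 2 x+y≡2z _ _ with m≤n⇒m<n∨m≡n x≤z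
    ... | inj₁ x<z = contradiction x+y≡2z (<⇒≢ (<-≤-trans (+-mono-<-≤ x<z y≤z) (≤-reflexive (cong (z +_) (sym (+-identityʳ z))))))
    ... | inj₂ x≡z = inj₁ (∣-reflexive x≡z)
    by-quotient (suc (suc (suc _))) _ _ (s≤s (s≤s (s≤s ())))

module _ {n : ℕ} {{_ : NonZero n}} where

  m≡o+qn⇒m%n≡o : ∀ {m o} q → o < n → m ≡ o + q * n → m % n ≡ o
  m≡o+qn⇒m%n≡o {o = o} q o<n refl = trans ([m+kn]%n≡m%n o q n) (m<n⇒m%n≡m o<n)

  a+pn≡b+qn⇒a%n≡b%n : ∀ {a b} p q → a + p * n ≡ b + q * n → a % n ≡ b % n
  a+pn≡b+qn⇒a%n≡b%n {a} {b} p q eq =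
    trans (sym ([m+kn]%n≡m%n a p n)) (trans (cong (_% n) eq) ([m+kn]%n≡m%n b q n))

  m*[k%n]%n≡m*k%n : ∀ m k → m * (k % n) % n ≡ m * k % n
  m*[k%n]%n≡m*k%n m k = a+pn≡b+qn⇒a%n≡b%n (m * (k / n)) 0 (begin
    m * (k % n) + m * (k / n) * n   ≡⟨ cong (m * (k % n) +_) (*-assoc m (k / n) n) ⟩
    m * (k % n) + m * (k / n * n)   ≡⟨ *-distribˡ-+ m (k % n) (k / n * n) ⟨
    m * (k % n + k / n * n)         ≡⟨ cong (m *_) (m≡m%n+[m/n]*n k n) ⟨
    m * k                           ≡⟨ +-identityʳ (m * k) ⟨
    m * k + 0 * n                   ∎)
    where open ≡-Reasoning

  [m%n]*a%n≡m*a%n : ∀ m a → m % n * a % n ≡ m * a % n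
  [m%n]*a%n≡m*a%n m a = begin
    m % n * a % n      ≡⟨ cong (_% n) (*-comm (m % n) a) ⟩
    a * (m % n) % n    ≡⟨ m*[k%n]%n≡m*k%n a m ⟩
    a * m % n          ≡⟨ cong (_% n) (*-comm a m) ⟩
    m * a % n          ∎
    where open ≡-Reasoning

  n∣m<2n⇒m≡n : ∀ {m} → n ∣ m → 0 < m → m < 2 * n → m ≡ n
  n∣m<2n⇒m≡n {m} (divides q m≡qn) m>0 m<2n = by-quotient q m≡qn (factor-pos n m≡qn m>0) (factor-< n 2 m≡qn m<2n)
    where
      by-quotient : ∀ q → m ≡ q * n → 0 < q → q < 2 → m ≡ n
      by-quotient 1 m≡n _ _ = trans m≡n (+-identityʳ n)
      by-quotient (suc (suc _)) _ _ (s≤s (s≤s ()))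

-- In the second Bézout case x a ≡ −1 (mod n), so (n − 1) x is the inverse.
modular-inverse : ∀ {a} n .{{_ : NonZero n}} → 1 < n → Coprime a n → ∃[ k ] (k < n × k * a % n ≡ 1)
modular-inverse {a} n@(suc m) 1<n a⊥n with coprime-Bézout a⊥n
... | Bézout.+- x y 1+yn≡xa =
  x % n , m%n<n x n , trans ([m%n]*a%n≡m*a%n x a) (m≡o+qn⇒m%n≡o y 1<n (sym 1+yn≡xa))
... | Bézout.-+ x y 1+xa≡yn =
  m * x % n , m%n<n (m * x) n ,
  trans ([m%n]*a%n≡m*a%n (m * x) a)
        (trans (a+pn≡b+qn⇒a%n≡b%n 1 (m * y) negated) (m<n⇒m%n≡m 1<n))
  where
    open ≡-Reasoning
    negated : m * x * a + 1 * n ≡ 1 + m * y * n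
    negated = begin
      m * x * a + 1 * n      ≡⟨ expand m x a ⟩
      1 + m * (1 + x * a)    ≡⟨ cong (λ t → 1 + m * t) 1+xa≡yn ⟩
      1 + m * (y * n)        ≡⟨ cong (1 +_) (*-assoc m y n) ⟨
      1 + m * y * n          ∎
      where
        expand : ∀ m x a → m * x * a + 1 * suc m ≡ 1 + m * (1 + x * a)
        expand = solve-∀

-- Residues of the multiples of the barycentric coordinates

module Residues (N : ℕ) {{_ : NonZero N}} (d : Fin 4 → ℕ) (d>0 : ∀ j → 0 < d j)
                (Σd≡N : sum4 d ≡ N) (d⊥N : ∀ j → Coprime (d j) N) where

  r : ℕ → Fin 4 → ℕ
  r k j = k * d j % N

  σ : ℕ → ℕ
  σ k = sum4 (r k)

  -- 1 if coordinate j wraps past N between steps k and k + 1, 0 otherwise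
  carry : ℕ → Fin 4 → ℕ
  carry k j = (r k j + d j) / N

  DividesComplementaryPair : Fin 4 → Set
  DividesComplementaryPair i = ∃[ j ] ∃[ k ] (j ≢ i × k ≢ i × j ≢ k × d i ∣ d j + d k)

  d≡1⊎2≤d : ∀ j → d j ≡ 1 ⊎ 2 ≤ d j
  d≡1⊎2≤d j with m≤n⇒m<n∨m≡n (d>0 j)
  ... | inj₁ d>1 = inj₂ d>1
  ... | inj₂ 1≡d = inj₁ (sym 1≡d)

  d+3≤N : ∀ j → d j + 3 ≤ N
  d+3≤N j = begin
    d j + 3                    ≡⟨ +-assoc (d j) 1 2 ⟨
    d j + 1 + (1 + 1)          ≤⟨ +-mono-≤ (+-monoʳ-≤ (d j) (d>0 l)) (+-mono-≤ (d>0 a) (d>0 b)) ⟩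
    d j + d l + (d a + d b)    ≡⟨ sum4-split d ⟨
    sum4 d                     ≡⟨ Σd≡N ⟩
    N                          ∎
    where
      open ≤-Reasoning
      l = proj₁ (another j)
      open Complement (complement j l (proj₂ (another j))) renaming (j to a; k to b)

  suc-d<N : ∀ j → suc (d j) < N
  suc-d<N j = ≤-trans (≤-trans (≤-reflexive (+-comm 2 (d j))) (+-monoʳ-≤ (d j) (n≤1+n 2))) (d+3≤N j)

  d<N : ∀ j → d j < N
  d<N j = <-trans (n<1+n (d j)) (suc-d<N j)

  3≤N : 3 ≤ N
  3≤N = ≤-trans (m≤n+m 3 (d f0)) (d+3≤N f0)

  N∣k*d⇒N∣k : ∀ {k} j → N ∣ k * d j → N ∣ k
  N∣k*d⇒N∣k {k} j N∣kd = coprime-divisor (⊥-sym (d⊥N j)) (subst (N ∣_) (*-comm k (d j)) N∣kd)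

  r<N : ∀ k j → r k j < N
  r<N k j = m%n<n (k * d j) N

  r>0 : ∀ {k} j → 0 < k → k < N → 0 < r k j
  r>0 {k} j k>0 k<N = n≢0⇒n>0 λ r≡0 →
    <⇒≱ k<N (∣⇒≤ {{>-nonZero k>0}} (N∣k*d⇒N∣k j (m%n≡0⇒n∣m (k * d j) N r≡0)))

  r-one : ∀ j → r 1 j ≡ d j
  r-one j = trans (cong (_% N) (*-identityˡ (d j))) (m<n⇒m%n≡m (d<N j))

  r-zero : ∀ j → r 0 j ≡ 0
  r-zero j = m<n⇒m%n≡m (>-nonZero⁻¹ N)

  quotient-decomposition : ∀ k j → k * d j ≡ r k j + (k * d j / N) * N
  quotient-decomposition k j = m≡m%n+[m/n]*n (k * d j) N

  r-reflect : ∀ {k m} j → 0 < k → 0 < m → k + m ≡ N → r k j + r m j ≡ N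
  r-reflect {k} {m} j k>0 m>0 k+m≡N = n∣m<2n⇒m≡n (m%n≡0⇒n∣m _ N sum%N≡0)
    (≤-trans (r>0 j m>0 m<N) (m≤n+m (r m j) (r k j)))
    (+-mono-< (r<N k j) (<-≤-trans (r<N m j) (m≤m+n N 0)))
    where
      open ≡-Reasoning
      m<N : m < N
      m<N = <-≤-trans (m<n+m m k>0) (≤-reflexive k+m≡N)
      sum%N≡0 : (r k j + r m j) % N ≡ 0
      sum%N≡0 = begin
        (r k j + r m j) % N        ≡⟨ %-distribˡ-+ (k * d j) (m * d j) N ⟨
        (k * d j + m * d j) % N    ≡⟨ cong (_% N) (*-distribʳ-+ (d j) k m) ⟨
        (k + m) * d j % N          ≡⟨ cong (λ x → x * d j % N) k+m≡N ⟩
        N * d j % N                ≡⟨ cong (_% N) (*-comm N (d j)) ⟩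
        d j * N % N                ≡⟨ m*n%n≡0 (d j) N ⟩
        0                          ∎

  r-step : ∀ k j → r (suc k) j + carry k j * N ≡ r k j + d j
  r-step k j = begin
    r (suc k) j + carry k j * N              ≡⟨ cong (_+ carry k j * N) r-suc ⟩
    (r k j + d j) % N + carry k j * N        ≡⟨ m≡m%n+[m/n]*n (r k j + d j) N ⟨
    r k j + d j                              ∎
    where
      open ≡-Reasoning
      r-suc : r (suc k) j ≡ (r k j + d j) % N
      r-suc = a+pn≡b+qn⇒a%n≡b%n 0 (k * d j / N) (begin
        d j + k * d j + 0 * N                    ≡⟨ +-identityʳ (d j + k * d j) ⟩
        d j + k * d j                            ≡⟨ cong (d j +_) (quotient-decomposition k j) ⟩
        d j + (r k j + k * d j / N * N)          ≡⟨ +-assoc (d j) (r k j) _ ⟨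
        d j + r k j + k * d j / N * N            ≡⟨ cong (_+ k * d j / N * N) (+-comm (d j) (r k j)) ⟩
        r k j + d j + k * d j / N * N            ∎)

  carry-sum : ∀ k → σ (suc k) + sum4 (carry k) * N ≡ σ k + N
  carry-sum k = begin
    σ (suc k) + sum4 (carry k) * N                        ≡⟨ cong (σ (suc k) +_) (sum4-*ʳ (carry k) N) ⟨
    σ (suc k) + sum4 (λ j → carry k j * N)                ≡⟨ sum4-+ (r (suc k)) (λ j → carry k j * N) ⟨
    sum4 (λ j → r (suc k) j + carry k j * N)              ≡⟨ sum4-cong (r-step k) ⟩
    sum4 (λ j → r k j + d j)                              ≡⟨ sum4-+ (r k) d ⟩
    σ k + sum4 d                                          ≡⟨ cong (σ k +_) Σd≡N ⟩
    σ k + N                                               ∎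
    where open ≡-Reasoning

  wraps⇒carry>0 : ∀ k j → N ≤ r k j + d j → 0 < carry k j
  wraps⇒carry>0 k j = m≥n⇒m/n>0

  carry>0⇒wraps : ∀ k j → 0 < carry k j → N ≤ r k j + d j
  carry>0⇒wraps k j carry>0 = m/n≢0⇒n≤m (>⇒≢ carry>0)

  N∣σ : ∀ k → N ∣ σ k
  N∣σ k = ∣m+n∣m⇒∣n (subst (N ∣_) (trans σ+qN≡kN (+-comm (σ k) _)) (n∣m*n k)) (n∣m*n (sum4 (λ j → k * d j / N)))
    where
      open ≡-Reasoning
      σ+qN≡kN : k * N ≡ σ k + sum4 (λ j → k * d j / N) * N
      σ+qN≡kN = begin
        k * N                                            ≡⟨ cong (k *_) Σd≡N ⟨
        k * sum4 d                                       ≡⟨ sum4-*ˡ k d ⟨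
        sum4 (λ j → k * d j)                             ≡⟨ sum4-cong (quotient-decomposition k) ⟩
        sum4 (λ j → r k j + (k * d j / N) * N)           ≡⟨ sum4-+ (r k) (λ j → (k * d j / N) * N) ⟩
        σ k + sum4 (λ j → (k * d j / N) * N)             ≡⟨ cong (σ k +_) (sum4-*ʳ (λ j → k * d j / N) N) ⟩
        σ k + sum4 (λ j → k * d j / N) * N               ∎

  σ<4N : ∀ k → σ k < 4 * N
  σ<4N k = <-≤-trans (+-mono-< (+-mono-< (+-mono-< (r<N k f0) (r<N k f1)) (r<N k f2)) (r<N k f3))
                     (≤-reflexive (sum4-const N))

  σ>0 : ∀ {k} → 0 < k → k < N → 0 < σ k
  σ>0 {k} k>0 k<N = <-≤-trans (r>0 f0 k>0 k<N) (≤sum4 (r k) f0)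

  σ-one : σ 1 ≡ N
  σ-one = trans (sum4-cong r-one) Σd≡N

  σ-reflect : ∀ {k} → 0 < k → k < N → σ (N ∸ k) + σ k ≡ 4 * N
  σ-reflect {k} k>0 k<N = begin
    σ (N ∸ k) + σ k                            ≡⟨ sum4-+ (r (N ∸ k)) (r k) ⟨
    sum4 (λ j → r (N ∸ k) j + r k j)           ≡⟨ sum4-cong (λ j → r-reflect j (m<n⇒0<n∸m k<N) k>0 (m∸n+n≡m (<⇒≤ k<N))) ⟩
    sum4 (λ _ → N)                             ≡⟨ sum4-const N ⟩
    4 * N                                      ∎
    where open ≡-Reasoning

  σ-values : ∀ {k} → 0 < k → k < N → σ k ≡ N ⊎ σ k ≡ 2 * N ⊎ σ k ≡ 3 * N
  σ-values {k} k>0 k<N = by-quotient q σ≡qN (factor-pos N σ≡qN (σ>0 k>0 k<N)) (factor-< N 4 σ≡qN (σ<4N k))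
    where
      q = quotient (N∣σ k)
      σ≡qN : σ k ≡ q * N
      σ≡qN = m∣n⇒n≡quotient*m (N∣σ k)
      by-quotient : ∀ q → σ k ≡ q * N → 0 < q → q < 4 → σ k ≡ N ⊎ σ k ≡ 2 * N ⊎ σ k ≡ 3 * N
      by-quotient 1 σ≡N _ _ = inj₁ (trans σ≡N (+-identityʳ N))
      by-quotient 2 σ≡2N _ _ = inj₂ (inj₁ σ≡2N)
      by-quotient 3 σ≡3N _ _ = inj₂ (inj₂ σ≡3N)
      by-quotient (suc (suc (suc (suc _)))) _ _ (s≤s (s≤s (s≤s (s≤s ()))))

  r-mul : ∀ c k j → r (c * k % N) j ≡ c * r k j % N
  r-mul c k j = begin
    c * k % N * d j % N     ≡⟨ [m%n]*a%n≡m*a%n (c * k) (d j) ⟩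
    c * k * d j % N         ≡⟨ cong (_% N) (*-assoc c k (d j)) ⟩
    c * (k * d j) % N       ≡⟨ m*[k%n]%n≡m*k%n c (k * d j) ⟨
    c * r k j % N           ∎
    where open ≡-Reasoning

  r-negate : ∀ {k j m τ} → m ≤ N → r k j + τ ≡ N → r ((N ∸ m) * k % N) j ≡ m * τ % N
  r-negate {k} {j} {m} {τ} m≤N rkj+τ≡N = begin
    r ((N ∸ m) * k % N) j          ≡⟨ r-mul (N ∸ m) k j ⟩
    (N ∸ m) * r k j % N            ≡⟨ cong (λ x → (N ∸ m) * x % N) rkj≡N∸τ ⟩
    (N ∸ m) * (N ∸ τ) % N          ≡⟨ a+pn≡b+qn⇒a%n≡b%n (m + τ) N
                                        (complement-product (N ∸ m) (N ∸ τ) m τ (m∸n+n≡m m≤N) (m∸n+n≡m τ≤N)) ⟩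
    m * τ % N                      ∎
    where
      open ≡-Reasoning
      τ≤N : τ ≤ N
      τ≤N = ≤-trans (m≤n+m τ (r k j)) (≤-reflexive rkj+τ≡N)
      rkj≡N∸τ : r k j ≡ N ∸ τ
      rkj≡N∸τ = trans (sym (m+n∸n≡m (r k j) τ)) (cong (_∸ τ) rkj+τ≡N)

  wraps-below : ∀ k {j m} → m ≤ d j → r k j ≡ N ∸ m → N ≤ r k j + d j
  wraps-below k {j} {m} m≤d r≡N∸m = begin
    N             ≡⟨ m∸n+n≡m (≤-trans m≤d (<⇒≤ (d<N j))) ⟨
    N ∸ m + m     ≤⟨ +-monoʳ-≤ (N ∸ m) m≤d ⟩
    N ∸ m + d j   ≡⟨ cong (_+ d j) r≡N∸m ⟨
    r k j + d j   ∎
    where open ≤-Reasoning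

  N<2N : N < 2 * N
  N<2N = m<m+n N (<-≤-trans (>-nonZero⁻¹ N) (m≤m+n N 0))

  -- Multiplying r k l + τ ≡ 0 by dᵢ, with k dᵢ ≡ 1, gives dₗ + dᵢ τ ≡ 0 (mod N).
  inverse-relation : ∀ {i l k τ} → r k i ≡ 1 → r k l + τ ≡ N → N ∣ d i * τ + d l
  inverse-relation {i} {l} {k} {τ} rki≡1 rkl+τ≡N = ∣m+n∣m⇒∣n (divides (d i + d i * b) (begin
    d l * a * N + (d i * τ + d l)   ≡⟨ regroup (d l) a N (d i) τ ⟩
    d i * τ + d l * (1 + a * N)     ≡⟨ cong (λ x → d i * τ + d l * x) kdi≡1+aN ⟨
    d i * τ + d l * (k * d i)       ≡⟨ cong (d i * τ +_) (swap-factors (d l) k (d i)) ⟩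
    d i * τ + d i * (k * d l)       ≡⟨ cong (λ x → d i * τ + d i * x) (quotient-decomposition k l) ⟩
    d i * τ + d i * (r k l + b * N) ≡⟨ collect (d i) τ (r k l) b N ⟩
    d i * (r k l + τ) + d i * b * N ≡⟨ cong (λ x → d i * x + d i * b * N) rkl+τ≡N ⟩
    d i * N + d i * b * N           ≡⟨ *-distribʳ-+ N (d i) (d i * b) ⟨
    (d i + d i * b) * N             ∎)) (n∣m*n (d l * a))
    where
      open ≡-Reasoning
      a = k * d i / N
      b = k * d l / N
      kdi≡1+aN : k * d i ≡ 1 + a * N
      kdi≡1+aN = trans (quotient-decomposition k i) (cong (_+ a * N) rki≡1)
      regroup : ∀ x a n y t → x * a * n + (y * t + x) ≡ y * t + x * (1 + a * n)
      regroup = solve-∀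
      swap-factors : ∀ x k y → x * (k * y) ≡ y * (k * x)
      swap-factors = solve-∀
      collect : ∀ y t R b n → y * t + y * (R + b * n) ≡ y * (R + t) + y * b * n
      collect = solve-∀

  wraps-if-multiple : ∀ k {j g q} → 0 < g → g ≤ d j → k * d j + g ≡ suc q * N → N ≤ r k j + d j
  wraps-if-multiple k {j} {g} {q} g>0 g≤d kd+g≡ =
    wraps-below k g≤d (m≡o+qn⇒m%n≡o q (∸-monoʳ-< g>0 g≤N) (m+n≡o+p⇒m≡o∸n+p g≤N kd+g≡))
    where
      g≤N : g ≤ N
      g≤N = ≤-trans g≤d (<⇒≤ (d<N j))

  first-wrap : ∀ {j} → 2 ≤ d j →
    ∃[ u ] ∃[ ε ] (suc u * d j ≡ N + ε × 0 < ε × ε < d j × 0 < u × suc u < N × N ≤ r u j + d j)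
  first-wrap {j} d≥2 = u , d j ∸ ρ , excess , m<n⇒0<n∸m ρ<d , ∸-monoʳ-< ρ>0 (<⇒≤ ρ<d) , u>0 , su<N , u-wraps
    where
      instance
        _ = >-nonZero (d>0 j)
      u = N / d j
      ρ = N % d j
      N≡ρ+ud : N ≡ ρ + u * d j
      N≡ρ+ud = m≡m%n+[m/n]*n N (d j)
      ρ<d : ρ < d j
      ρ<d = m%n<n N (d j)
      ρ>0 : 0 < ρ
      ρ>0 = n≢0⇒n>0 λ ρ≡0 → <⇒≢ d≥2 (sym (d⊥N j (∣-refl , m%n≡0⇒n∣m N (d j) ρ≡0)))
      ud<N : u * d j < N
      ud<N = <-≤-trans (m<n+m (u * d j) ρ>0) (≤-reflexive (sym N≡ρ+ud))
      u>0 : 0 < u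
      u>0 = n≢0⇒n>0 λ u≡0 → <-asym (d<N j)
        (≤-<-trans (≤-reflexive (trans N≡ρ+ud (trans (cong (λ x → ρ + x * d j) u≡0) (+-identityʳ ρ)))) ρ<d)
      su<N : suc u < N
      su<N = begin-strict
        suc u      ≡⟨ +-comm 1 u ⟩
        u + 1      ≤⟨ +-monoʳ-≤ u u>0 ⟩
        u + u      ≡⟨ trans (*-comm u 2) (cong (u +_) (+-identityʳ u)) ⟨
        u * 2      ≤⟨ *-monoʳ-≤ u d≥2 ⟩
        u * d j    <⟨ ud<N ⟩
        N          ∎
        where open ≤-Reasoning
      u-wraps : N ≤ r u j + d j
      u-wraps = begin
        N                ≡⟨ N≡ρ+ud ⟩
        ρ + u * d j      ≤⟨ +-monoˡ-≤ (u * d j) (<⇒≤ ρ<d) ⟩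
        d j + u * d j    ≡⟨ +-comm (d j) (u * d j) ⟩
        u * d j + d j    ≡⟨ cong (_+ d j) (m<n⇒m%n≡m ud<N) ⟨
        r u j + d j      ∎
        where open ≤-Reasoning
      excess : suc u * d j ≡ N + (d j ∸ ρ)
      excess = begin
        d j + u * d j            ≡⟨ cong (_+ u * d j) (m+[n∸m]≡n (<⇒≤ ρ<d)) ⟨
        ρ + (d j ∸ ρ) + u * d j  ≡⟨ rearrange ρ (d j ∸ ρ) (u * d j) ⟩
        ρ + u * d j + (d j ∸ ρ)  ≡⟨ cong (_+ (d j ∸ ρ)) N≡ρ+ud ⟨
        N + (d j ∸ ρ)            ∎
        where
          open ≡-Reasoning
          rearrange : ∀ x y z → x + y + z ≡ x + z + y
          rearrange = solve-∀

  -- The geometric input, established for the tetrahedron at the end.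
  module _ (σ≡N⇒k≡1 : ∀ {k} → 0 < k → k < N → σ k ≡ N → k ≡ 1) where

    σ≤2N : ∀ {k} → 0 < k → suc k < N → σ k ≤ 2 * N
    σ≤2N {k} k>0 sk<N = by-value (σ-values k>0 k<N)
      where
        k<N : k < N
        k<N = <-trans (n<1+n k) sk<N
        σ[N∸k]≡N : σ k ≡ 3 * N → σ (N ∸ k) ≡ N
        σ[N∸k]≡N σ≡3N = +-cancelʳ-≡ (3 * N) (σ (N ∸ k)) N
          (trans (trans (cong (σ (N ∸ k) +_) (sym σ≡3N)) (σ-reflect k>0 k<N)) (sym (one+three N)))
          where
            one+three : ∀ n → n + 3 * n ≡ 4 * n
            one+three = solve-∀
        by-value : σ k ≡ N ⊎ σ k ≡ 2 * N ⊎ σ k ≡ 3 * N → σ k ≤ 2 * N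
        by-value (inj₁ σ≡N) = ≤-trans (≤-reflexive σ≡N) (<⇒≤ N<2N)
        by-value (inj₂ (inj₁ σ≡2N)) = ≤-reflexive σ≡2N
        by-value (inj₂ (inj₂ σ≡3N)) = contradiction N≡suc-k (>⇒≢ sk<N)
          where
            N∸k≡1 : N ∸ k ≡ 1
            N∸k≡1 = σ≡N⇒k≡1 (m<n⇒0<n∸m k<N) (∸-monoʳ-< k>0 (<⇒≤ k<N)) (σ[N∸k]≡N σ≡3N)
            N≡suc-k : N ≡ suc k
            N≡suc-k = trans (sym (m∸n+n≡m (<⇒≤ k<N))) (cong (_+ k) N∸k≡1)

    2N≤σ : ∀ {k} → 1 < k → k < N → 2 * N ≤ σ k
    2N≤σ {k} k>1 k<N = by-value (σ-values k>0 k<N)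
      where
        k>0 = <-trans z<s k>1
        by-value : σ k ≡ N ⊎ σ k ≡ 2 * N ⊎ σ k ≡ 3 * N → 2 * N ≤ σ k
        by-value (inj₁ σ≡N) = contradiction (σ≡N⇒k≡1 k>0 k<N σ≡N) (>⇒≢ k>1)
        by-value (inj₂ (inj₁ σ≡2N)) = ≤-reflexive (sym σ≡2N)
        by-value (inj₂ (inj₂ σ≡3N)) = ≤-trans (*-monoˡ-≤ N (n≤1+n 2)) (≤-reflexive (sym σ≡3N))

    at-most-one-wrap : ∀ {k a b} → 0 < k → suc k < N → b ≢ a →
                       N ≤ r k a + d a → N ≤ r k b + d b → ⊥
    at-most-one-wrap {k} {a} {b} k>0 sk<N b≢a a-wraps b-wraps = <⇒≱ N<2N (+-cancelˡ-≤ (2 * N) (2 * N) N (begin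
      2 * N + 2 * N                    ≤⟨ +-mono-≤ (2N≤σ (s≤s k>0) sk<N) (*-monoˡ-≤ N two-carries) ⟩
      σ (suc k) + sum4 (carry k) * N   ≡⟨ carry-sum k ⟩
      σ k + N                          ≤⟨ +-monoˡ-≤ N (σ≤2N k>0 sk<N) ⟩
      2 * N + N                        ∎))
      where
        open ≤-Reasoning
        two-carries : 2 ≤ sum4 (carry k)
        two-carries = ≤-trans (+-mono-≤ (wraps⇒carry>0 k a a-wraps) (wraps⇒carry>0 k b b-wraps)) (pair≤sum4 (carry k) b≢a)

    some-wrap : ∀ {k} → 1 < k → suc (suc k) < N → ∃[ j ] N ≤ r k j + d j
    some-wrap {k} k>1 ssk<N = map₂ (carry>0⇒wraps k _) (sum4-pos⇒pos (carry k) (n≢0⇒n>0 no-carry-impossible))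
      where
        no-carry-impossible : sum4 (carry k) ≢ 0
        no-carry-impossible Σcarry≡0 = <⇒≱ (+-monoʳ-< (2 * N) (>-nonZero⁻¹ N)) (begin
          2 * N + N                        ≤⟨ +-monoˡ-≤ N (2N≤σ k>1 (<-trans (n<1+n k) (<-trans (n<1+n (suc k)) ssk<N))) ⟩
          σ k + N                          ≡⟨ carry-sum k ⟨
          σ (suc k) + sum4 (carry k) * N   ≡⟨ cong (λ c → σ (suc k) + c * N) Σcarry≡0 ⟩
          σ (suc k) + 0                    ≤⟨ +-monoˡ-≤ 0 (σ≤2N z<s ssk<N) ⟩
          2 * N + 0                        ∎)
          where open ≤-Reasoning

    -- Nothing wraps at step 1, since σ 1 = N and σ 2 = 2N.
    2d<N : ∀ j → 2 * d j < N
    2d<N j = ≰⇒> λ N≤2d → <⇒≱ (+-monoʳ-< (2 * N) (>-nonZero⁻¹ N)) (begin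
      2 * N + N                        ≤⟨ +-mono-≤ (2N≤σ ≤-refl 3≤N) (≤-trans (≤-reflexive (sym (*-identityˡ N))) (*-monoˡ-≤ N (carry-at-one N≤2d))) ⟩
      σ 2 + sum4 (carry 1) * N         ≡⟨ carry-sum 1 ⟩
      σ 1 + N                          ≡⟨ cong (_+ N) σ-one ⟩
      N + N                            ≡⟨ cong (N +_) (+-identityʳ N) ⟨
      2 * N                            ≤⟨ m≤m+n (2 * N) 0 ⟩
      2 * N + 0                        ∎)
      where
        open ≤-Reasoning
        carry-at-one : N ≤ 2 * d j → 1 ≤ sum4 (carry 1)
        carry-at-one N≤2d = ≤-trans (wraps⇒carry>0 1 j (subst (N ≤_) (cong₂ _+_ (sym (r-one j)) (+-identityʳ (d j))) N≤2d))
                                    (≤sum4 (carry 1) j)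

    inverse-range : ∀ {i k} → 2 ≤ d i → N ≢ suc (2 * d i) → k < N → r k i ≡ 1 → 1 < k × suc (suc k) < N
    inverse-range {i} {k} d≥2 N≢2d+1 k<N rk≡1 = k>1 , ≤∧≢⇒< (≤∧≢⇒< k<N sk≢N) ssk≢N
      where
        above-one : ∀ k → r k i ≡ 1 → 1 < k
        above-one 0 r0≡1 = contradiction (trans (sym (r-zero i)) r0≡1) (λ ())
        above-one 1 r1≡1 = contradiction (trans (sym (r-one i)) r1≡1) (>⇒≢ d≥2)
        above-one (suc (suc _)) _ = s≤s (s≤s z≤n)
        k>1 : 1 < k
        k>1 = above-one k rk≡1
        sk≢N : suc k ≢ N
        sk≢N sk≡N = <⇒≢ (suc-d<N i) (trans (cong₂ _+_ (sym rk≡1) (sym (r-one i)))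
                                          (r-reflect i (<-trans z<s k>1) z<s (trans (+-comm k 1) sk≡N)))
        ssk≢N : suc (suc k) ≢ N
        ssk≢N ssk≡N = N≢2d+1 (sym (trans (cong₂ _+_ (sym rk≡1) (sym r2≡2d))
                                         (r-reflect i (<-trans z<s k>1) z<s (trans (+-comm k 2) ssk≡N))))
          where
            r2≡2d : r 2 i ≡ 2 * d i
            r2≡2d = m<n⇒m%n≡m (2d<N i)

    -- Write (1 + w) N = m τ + δ with 0 < δ ≤ τ: then at κ ≡ −m k both i and l wrap.
    no-large-multiple : ∀ {i l k τ w} → l ≢ i → r k i ≡ 1 → τ ≤ d l → r k l + τ ≡ N →
                        d i * τ + d l ≡ (2 + w) * N →
                        ∃[ m ] ∃[ δ ] (m * τ + δ ≡ suc w * N × 0 < δ × δ ≤ τ) → ⊥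
    no-large-multiple {i} {l} {k} {τ} {w} l≢i rki≡1 τ≤dl rkl+τ≡N excess (m , δ , mτ+δ≡M , δ>0 , δ≤τ) =
      at-most-one-wrap κ>0 sκ<N l≢i (wraps-below κ (<⇒≤ m<di) rκi≡N∸m) (wraps-below κ δ≤dl rκl≡N∸δ)
      where
        M = suc w * N
        δ≤dl : δ ≤ d l
        δ≤dl = ≤-trans δ≤τ τ≤dl
        δ<N : δ < N
        δ<N = ≤-<-trans δ≤dl (d<N l)
        M<diτ : M < d i * τ
        M<diτ = +-cancelʳ-< (d l) M (d i * τ)
          (<-≤-trans (+-monoʳ-< M (d<N l)) (≤-reflexive (trans (+-comm M N) (sym excess))))
        m<di : m < d i
        m<di = *-cancelʳ-< τ m (d i) (<-trans (<-≤-trans (m<m+n (m * τ) δ>0) (≤-reflexive mτ+δ≡M)) M<diτ)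
        m<N : m < N
        m<N = <-trans m<di (d<N i)
        m>0 : 0 < m
        m>0 = n≢0⇒n>0 λ m≡0 → <⇒≱ δ<N
          (≤-trans (m≤m+n N (w * N)) (≤-reflexive (sym (trans (cong (λ x → x * τ + δ) (sym m≡0)) mτ+δ≡M))))
        κ = (N ∸ m) * k % N
        rκi≡N∸m : r κ i ≡ N ∸ m
        rκi≡N∸m = trans (r-mul (N ∸ m) k i) (trans (cong (λ x → (N ∸ m) * x % N) rki≡1)
          (trans (cong (_% N) (*-identityʳ (N ∸ m))) (m<n⇒m%n≡m (∸-monoʳ-< m>0 (<⇒≤ m<N)))))
        rκl≡N∸δ : r κ l ≡ N ∸ δ
        rκl≡N∸δ = trans (r-negate (<⇒≤ m<N) rkl+τ≡N)
          (m≡o+qn⇒m%n≡o w (∸-monoʳ-< δ>0 (<⇒≤ δ<N)) (m+n≡o+p⇒m≡o∸n+p (<⇒≤ δ<N) mτ+δ≡M))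
        κ>0 : 0 < κ
        κ>0 = n≢0⇒n>0 λ κ≡0 → <⇒≢ (m<n⇒0<n∸m m<N)
          (trans (sym (r-zero i)) (subst (λ x → r x i ≡ N ∸ m) κ≡0 rκi≡N∸m))
        sκ<N : suc κ < N
        sκ<N = ≤∧≢⇒< (m%n<n ((N ∸ m) * k) N) λ sκ≡N → <⇒≢ m<di (sym (+-cancelˡ-≡ (N ∸ m) (d i) m (begin
          N ∸ m + d i     ≡⟨ cong₂ _+_ rκi≡N∸m (r-one i) ⟨
          r κ i + r 1 i   ≡⟨ r-reflect i κ>0 z<s (trans (+-comm κ 1) sκ≡N) ⟩
          N               ≡⟨ m∸n+n≡m (<⇒≤ m<N) ⟨
          N ∸ m + m       ∎)))
          where open ≡-Reasoning

    generic-case : ∀ {i} → 2 ≤ d i → N ≢ suc (2 * d i) → ∃[ l ] (l ≢ i × ∃[ τ ] d i * τ + d l ≡ N)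
    generic-case {i} d≥2 N≢2d+1 = l , l≢i , τ , by-quotient (quotient N∣diτ+dl) (m∣n⇒n≡quotient*m N∣diτ+dl)
      where
        inverse = modular-inverse N (<-≤-trans (s≤s (s≤s z≤n)) 3≤N) (d⊥N i)
        k = proj₁ inverse
        rki≡1 : r k i ≡ 1
        rki≡1 = proj₂ (proj₂ inverse)
        k-range = inverse-range {k = k} d≥2 N≢2d+1 (proj₁ (proj₂ inverse)) rki≡1
        wrap = some-wrap (proj₁ k-range) (proj₂ k-range)
        l = proj₁ wrap
        l≢i : l ≢ i
        l≢i l≡i = <⇒≱ (subst (λ x → x + d i < N) (sym rki≡1) (suc-d<N i))
                      (subst (λ j → N ≤ r k j + d j) l≡i (proj₂ wrap))
        τ = N ∸ r k l
        rkl+τ≡N : r k l + τ ≡ N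
        rkl+τ≡N = m+[n∸m]≡n (<⇒≤ (r<N k l))
        τ≤dl : τ ≤ d l
        τ≤dl = +-cancelˡ-≤ (r k l) τ (d l) (subst (_≤ r k l + d l) (sym rkl+τ≡N) (proj₂ wrap))
        N∣diτ+dl : N ∣ d i * τ + d l
        N∣diτ+dl = inverse-relation {k = k} rki≡1 rkl+τ≡N
        by-quotient : ∀ W → d i * τ + d l ≡ W * N → d i * τ + d l ≡ N
        by-quotient 0 ≡0 = contradiction ≡0 (>⇒≢ (<-≤-trans (d>0 l) (m≤n+m (d l) (d i * τ))))
        by-quotient 1 ≡N = trans ≡N (+-identityʳ N)
        by-quotient (suc (suc w)) excess = ⊥-elim (no-large-multiple {k = k} {w = w} l≢i rki≡1 τ≤dl rkl+τ≡N excess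
          (division-with-positive-remainder (m<n⇒0<n∸m (r<N k l)) (<-≤-trans (>-nonZero⁻¹ N) (m≤m+n N (w * N)))))

    2d∣N+1⇒¬d∣d′ : ∀ {j j'} → j' ≢ j → 2 ≤ d j → ∃[ b ] 2 * b * d j ≡ suc N → ¬ d j ∣ d j'
    2d∣N+1⇒¬d∣d′ {j} {j'} _ _ _ (divides 0 dj'≡0) = <⇒≢ (d>0 j') (sym dj'≡0)
    2d∣N+1⇒¬d∣d′ {j} {j'} j'≢j d≥2 (suc a , 2bd≡N+1) (divides c@(suc c') dj'≡cdj) =
      at-most-one-wrap z<s sκ<N j'≢j
        (wraps-if-multiple κ {q = 0} (m<n⇒0<n∸m d≥2) (m∸n≤m (d j) 1) κd+[d∸1]≡N)
        (wraps-if-multiple κ {q = c'} (m<n⇒0<n∸m c<dj') (m∸n≤m (d j') c) κd'+[d'∸c]≡cN)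
      where
        κ = suc (2 * a)
        sκd≡N+1 : suc κ * d j ≡ suc N
        sκd≡N+1 = trans (cong (_* d j) (sym (*-suc 2 a))) 2bd≡N+1
        sκ<N : suc κ < N
        sκ<N = factor<n (s≤s (s≤s z≤n)) d≥2 sκd≡N+1
        c<dj' : c < d j'
        c<dj' = subst₂ _<_ (*-identityʳ c) (sym dj'≡cdj) (*-monoʳ-< c d≥2)
        κd+[d∸1]≡N : κ * d j + (d j ∸ 1) ≡ 1 * N
        κd+[d∸1]≡N = +-cancelʳ-≡ 1 (κ * d j + (d j ∸ 1)) (1 * N) (begin
          κ * d j + (d j ∸ 1) + 1      ≡⟨ +-assoc (κ * d j) (d j ∸ 1) 1 ⟩
          κ * d j + (d j ∸ 1 + 1)      ≡⟨ cong (κ * d j +_) (m∸n+n≡m (d>0 j)) ⟩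
          κ * d j + d j                ≡⟨ +-comm (κ * d j) (d j) ⟩
          suc κ * d j                  ≡⟨ sκd≡N+1 ⟩
          1 + N                        ≡⟨ +-comm 1 N ⟩
          N + 1                        ≡⟨ cong (_+ 1) (*-identityˡ N) ⟨
          1 * N + 1                    ∎)
          where open ≡-Reasoning
        κd'+[d'∸c]≡cN : κ * d j' + (d j' ∸ c) ≡ c * N
        κd'+[d'∸c]≡cN = +-cancelʳ-≡ c (κ * d j' + (d j' ∸ c)) (c * N) (begin
          κ * d j' + (d j' ∸ c) + c    ≡⟨ +-assoc (κ * d j') (d j' ∸ c) c ⟩
          κ * d j' + (d j' ∸ c + c)    ≡⟨ cong (κ * d j' +_) (m∸n+n≡m (<⇒≤ c<dj')) ⟩
          κ * d j' + d j'              ≡⟨ cong (λ x → κ * x + x) dj'≡cdj ⟩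
          κ * (c * d j) + c * d j      ≡⟨ factor κ c (d j) ⟩
          c * (suc κ * d j)            ≡⟨ cong (c *_) sκd≡N+1 ⟩
          c * suc N                    ≡⟨ *-suc c N ⟩
          c + c * N                    ≡⟨ +-comm c (c * N) ⟩
          c * N + c                    ∎)
          where
            open ≡-Reasoning
            factor : ∀ κ c d → κ * (c * d) + c * d ≡ c * (d + κ * d)
            factor = solve-∀

    -- The exceptional case: here dᵢ⁻¹ ≡ −2 lies outside the range of some-wrap.
    module _ {i} (N≡2d+1 : N ≡ suc (2 * d i)) where

      wraps-at-even : ∀ {a} → 0 < a → a ≤ d i → N ≤ r (2 * a) i + d i
      wraps-at-even {a@(suc a')} a>0 a≤d = wraps-if-multiple (2 * a) {q = a'} a>0 a≤d (begin
        2 * a * d i + a          ≡⟨ factor a (d i) ⟩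
        a * suc (2 * d i)        ≡⟨ cong (a *_) N≡2d+1 ⟨
        a * N                    ∎)
        where
          open ≡-Reasoning
          factor : ∀ a d → 2 * a * d + a ≡ a * suc (2 * d)
          factor = solve-∀

      no-even-wrap : ∀ {j a} → j ≢ i → 0 < a → suc (2 * a) < N → ¬ N ≤ r (2 * a) j + d j
      no-even-wrap {j} {a} j≢i a>0 2a+1<N =
        at-most-one-wrap (*-monoʳ-< 2 a>0) 2a+1<N j≢i (wraps-at-even a>0 (<⇒≤ a<d))
        where
          a<d : a < d i
          a<d = *-cancelˡ-< 2 a (d i) (≤-pred (subst (suc (2 * a) <_) N≡2d+1 2a+1<N))

      -- With d j = m ε + δ (0 < δ ≤ ε), j wraps at the even step 2 (a + m (a + 1)).
      no-large-excess : ∀ {j a ε} → j ≢ i → 2 * suc a * d j ≡ N + ε → 2 ≤ ε → ε < d j →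
                        ∃[ m ] ∃[ δ ] (m * ε + δ ≡ d j × 0 < δ × δ ≤ ε) → ⊥
      no-large-excess {j} {a} {ε} j≢i excess ε≥2 ε<d (m , δ , mε+δ≡d , δ>0 , δ≤ε) =
        no-even-wrap j≢i (<-≤-trans (proj₁ range) (≤-trans (m≤m*n m (suc a)) (m≤n+m (m * suc a) a))) (proj₂ range)
          (wraps-if-multiple (2 * (a + m * suc a)) {q = m} g>0 g≤d (excess-identity {a = a} {m = m} excess mε+δ≡d ε≤d+δ))
        where
          range = excess-range {a = a} {m = m} excess mε+δ≡d δ>0 δ≤ε ε≥2 ε<d (2d<N j)
          ε≤d+δ : ε ≤ d j + δ
          ε≤d+δ = ≤-trans (<⇒≤ ε<d) (m≤m+n (d j) δ)
          g>0 : 0 < d j + δ ∸ ε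
          g>0 = m<n⇒0<n∸m (<-≤-trans ε<d (m≤m+n (d j) δ))
          g≤d : d j + δ ∸ ε ≤ d j
          g≤d = +-cancelʳ-≤ ε (d j + δ ∸ ε) (d j)
            (subst (_≤ d j + ε) (sym (m∸n+n≡m ε≤d+δ)) (+-monoʳ-≤ (d j) δ≤ε))

      -- j first wraps at u = ⌊N / d j⌋, so u is odd, and then (u + 1) d j − N must be 1.
      2d∣N+1 : ∀ {j} → j ≢ i → 2 ≤ d j → ∃[ b ] 2 * b * d j ≡ suc N
      2d∣N+1 {j} j≢i d≥2 = from-first-wrap (first-wrap d≥2)
        where
          from-excess : ∀ {a} ε → 2 * suc a * d j ≡ N + ε → 0 < ε → ε < d j → ∃[ b ] 2 * b * d j ≡ suc N
          from-excess {a} 1 excess _ _ = suc a , trans excess (+-comm N 1)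
          from-excess {a} ε@(suc (suc _)) excess _ ε<d = ⊥-elim (no-large-excess {a = a} j≢i excess (s≤s (s≤s z≤n)) ε<d
            (division-with-positive-remainder z<s (d>0 j)))
          from-first-wrap : ∃[ u ] ∃[ ε ] (suc u * d j ≡ N + ε × 0 < ε × ε < d j × 0 < u × suc u < N × N ≤ r u j + d j) →
                            ∃[ b ] 2 * b * d j ≡ suc N
          from-first-wrap (u , ε , sud≡N+ε , ε>0 , ε<d , u>0 , su<N , u-wraps) with even-or-odd u
          ... | a , inj₁ u≡2a = ⊥-elim (no-even-wrap {a = a} j≢i (n≢0⇒n>0 λ a≡0 → >⇒≢ u>0 (trans u≡2a (cong (2 *_) a≡0)))
                  (subst (λ x → suc x < N) u≡2a su<N) (subst (λ x → N ≤ r x j + d j) u≡2a u-wraps))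
          ... | a , inj₂ u≡2a+1 = from-excess {a} ε
                  (trans (cong (_* d j) (trans (*-suc 2 a) (cong suc (sym u≡2a+1)))) sud≡N+ε) ε>0 ε<d

      2d∣N+1⇒d∣dᵢ+1 : ∀ {o} → ∃[ b ] 2 * b * d o ≡ suc N → d o ∣ suc (d i)
      2d∣N+1⇒d∣dᵢ+1 {o} (b , 2bd≡N+1) = divides b (sym (*-cancelˡ-≡ (b * d o) (suc (d i)) 2 (begin
        2 * (b * d o)         ≡⟨ *-assoc 2 b (d o) ⟨
        2 * b * d o           ≡⟨ 2bd≡N+1 ⟩
        suc N                 ≡⟨ cong suc N≡2d+1 ⟩
        suc (suc (2 * d i))   ≡⟨ *-suc 2 (d i) ⟨
        2 * suc (d i)         ∎)))
        where open ≡-Reasoning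

      no-sorted-triple : ∀ {x y z} → x ≢ i → y ≢ i → z ≢ i → x ≢ y → x ≢ z → y ≢ z →
                         2 ≤ d x → 2 ≤ d y → 2 ≤ d z → d x ≤ d z → d y ≤ d z →
                         d x + d y + d z ≡ suc (d i) → ⊥
      no-sorted-triple {x} {y} {z} x≢i y≢i z≢i x≢y x≢z y≢z dx≥2 dy≥2 dz≥2 dx≤dz dy≤dz sum≡ =
        by-cases (divisor-among-three (d>0 x) (d>0 y) dx≤dz dy≤dz (divides-sum hx) (divides-sum hy) (divides-sum hz))
        where
          hx = 2d∣N+1 x≢i dx≥2
          hy = 2d∣N+1 y≢i dy≥2
          hz = 2d∣N+1 z≢i dz≥2
          divides-sum : ∀ {o} → ∃[ b ] 2 * b * d o ≡ suc N → d o ∣ d x + d y + d z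
          divides-sum {o} half = subst (d o ∣_) (sym sum≡) (2d∣N+1⇒d∣dᵢ+1 half)
          by-cases : d x ∣ d z ⊎ d x ∣ d y ⊎ d y ∣ d x → ⊥
          by-cases (inj₁ dx∣dz) = 2d∣N+1⇒¬d∣d′ (x≢z ∘ sym) dx≥2 hx dx∣dz
          by-cases (inj₂ (inj₁ dx∣dy)) = 2d∣N+1⇒¬d∣d′ (x≢y ∘ sym) dx≥2 hx dx∣dy
          by-cases (inj₂ (inj₂ dy∣dx)) = 2d∣N+1⇒¬d∣d′ x≢y dy≥2 hy dy∣dx

      no-triple : ∀ {x y z} → x ≢ i → y ≢ i → z ≢ i → x ≢ y → x ≢ z → y ≢ z →
                  2 ≤ d x → 2 ≤ d y → 2 ≤ d z → d x + d y + d z ≡ suc (d i) → ⊥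
      no-triple {x} {y} {z} x≢i y≢i z≢i x≢y x≢z y≢z dx≥2 dy≥2 dz≥2 sum≡ with largest-of-three (d x) (d y) (d z)
      ... | inj₁ (dx≤dz , dy≤dz) = no-sorted-triple x≢i y≢i z≢i x≢y x≢z y≢z dx≥2 dy≥2 dz≥2 dx≤dz dy≤dz sum≡
      ... | inj₂ (inj₁ (dy≤dx , dz≤dx)) = no-sorted-triple y≢i z≢i x≢i y≢z (x≢y ∘ sym) (x≢z ∘ sym)
              dy≥2 dz≥2 dx≥2 dy≤dx dz≤dx (trans (rotate (d x) (d y) (d z)) sum≡)
        where
          rotate : ∀ a b c → b + c + a ≡ a + b + c
          rotate = solve-∀
      ... | inj₂ (inj₂ (dx≤dy , dz≤dy)) = no-sorted-triple x≢i z≢i y≢i x≢z x≢y (y≢z ∘ sym)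
              dx≥2 dz≥2 dy≥2 dx≤dy dz≤dy (trans (swap-last (d x) (d y) (d z)) sum≡)
        where
          swap-last : ∀ a b c → a + c + b ≡ a + b + c
          swap-last = solve-∀

      exceptional-case : DividesComplementaryPair i
      exceptional-case = by-size (d≡1⊎2≤d l) (d≡1⊎2≤d j) (d≡1⊎2≤d k)
        where
          l = proj₁ (another i)
          open Complement (complement i l (proj₂ (another i)))
          others≡ : d l + d j + d k ≡ suc (d i)
          others≡ = +-cancelˡ-≡ (d i) (d l + d j + d k) (suc (d i)) (begin
            d i + (d l + d j + d k)    ≡⟨ cong (d i +_) (+-assoc (d l) (d j) (d k)) ⟩
            d i + (d l + (d j + d k))  ≡⟨ +-assoc (d i) (d l) (d j + d k) ⟨
            d i + d l + (d j + d k)    ≡⟨ sum4-split d ⟨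
            sum4 d                     ≡⟨ trans Σd≡N N≡2d+1 ⟩
            suc (d i + (d i + 0))      ≡⟨ cong suc (cong (d i +_) (+-identityʳ (d i))) ⟩
            suc (d i + d i)            ≡⟨ +-suc (d i) (d i) ⟨
            d i + suc (d i)            ∎)
            where open ≡-Reasoning
          by-size : d l ≡ 1 ⊎ 2 ≤ d l → d j ≡ 1 ⊎ 2 ≤ d j → d k ≡ 1 ⊎ 2 ≤ d k → DividesComplementaryPair i
          by-size (inj₁ dl≡1) _ _ = j , k , j≢i , k≢i , j≢k ,
            ∣-reflexive (sym (suc-injective (subst (λ x → x + d j + d k ≡ suc (d i)) dl≡1 others≡)))
          by-size _ (inj₁ dj≡1) _ = l , k , proj₂ (another i) , k≢i , k≢l ∘ sym ,
            ∣-reflexive (sym (suc-injective (trans (move (d l) (d k)) (subst (λ x → d l + x + d k ≡ suc (d i)) dj≡1 others≡))))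
            where
              move : ∀ a c → suc (a + c) ≡ a + 1 + c
              move = solve-∀
          by-size _ _ (inj₁ dk≡1) = l , j , proj₂ (another i) , j≢i , j≢l ∘ sym ,
            ∣-reflexive (sym (suc-injective (trans (+-comm 1 (d l + d j)) (subst (λ x → d l + d j + x ≡ suc (d i)) dk≡1 others≡))))
          by-size (inj₂ dl≥2) (inj₂ dj≥2) (inj₂ dk≥2) =
            ⊥-elim (no-triple (proj₂ (another i)) j≢i k≢i (j≢l ∘ sym) (k≢l ∘ sym) j≢k dl≥2 dj≥2 dk≥2 others≡)

    complementary-pair-divisible : ∀ i → DividesComplementaryPair i
    complementary-pair-divisible i = by-case (d≡1⊎2≤d i) (N ≟ suc (2 * d i))
      where
        from-generic-case : ∃[ l ] (l ≢ i × ∃[ τ ] d i * τ + d l ≡ N) → DividesComplementaryPair i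
        from-generic-case (l , l≢i , τ , diτ+dl≡N) = j , k , j≢i , k≢i , j≢k , ∣m+n∣m⇒∣n (divides τ diτ≡) ∣-refl
          where
            open Complement (complement i l l≢i)
            diτ≡ : d i + (d j + d k) ≡ τ * d i
            diτ≡ = +-cancelʳ-≡ (d l) (d i + (d j + d k)) (τ * d i) (begin
              d i + (d j + d k) + d l     ≡⟨ rearrange (d i) (d l) (d j + d k) ⟩
              d i + d l + (d j + d k)     ≡⟨ sum4-split d ⟨
              sum4 d                      ≡⟨ Σd≡N ⟩
              N                           ≡⟨ diτ+dl≡N ⟨
              d i * τ + d l               ≡⟨ cong (_+ d l) (*-comm (d i) τ) ⟩
              τ * d i + d l               ∎)
              where
                open ≡-Reasoning
                rearrange : ∀ x y z → x + z + y ≡ x + y + z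
                rearrange = solve-∀
        by-case : d i ≡ 1 ⊎ 2 ≤ d i → Dec (N ≡ suc (2 * d i)) → DividesComplementaryPair i
        by-case (inj₁ d≡1) _ = j , k , j≢i , k≢i , j≢k , subst (_∣ d j + d k) (sym d≡1) (1∣ (d j + d k))
          where open Complement (complement i (proj₁ (another i)) (proj₂ (another i)))
        by-case (inj₂ d≥2) (yes N≡2d+1) = exceptional-case N≡2d+1
        by-case (inj₂ d≥2) (no N≢2d+1) = from-generic-case (generic-case d≥2 N≢2d+1)

module _ {v : Tetra} {w : Point} (one-point : OnePointWith v w) (N : ℕ) {{_ : NonZero N}}
         (d : Fin 4 → ℕ) (d>0 : ∀ j → 0 < d j) (Σd≡N : sum4 d ≡ N) (d⊥N : ∀ j → Coprime (d j) N)
         (Nw≡comb : scale N w ≈ₚ comb d v) where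

  open Residues N d d>0 Σd≡N d⊥N

  σ≡N⇒k≡1 : ∀ {k} → 0 < k → k < N → σ k ≡ N → k ≡ 1
  σ≡N⇒k≡1 {suc k'} _ k<N σ≡N = cong suc (multiple<N⇒≡0 k' (<-trans (n<1+n k') k<N) N∣k')
    where
      p = translate (suc k') (λ j → suc k' * d j / N) v w
      Np≡comb : scale N p ≈ₚ comb (r (suc k')) v
      Np≡comb = translate-barycentric {v = v} {w = w} {N = N} {k = suc k'} {d = d}
                  {q = λ j → suc k' * d j / N} {r = r (suc k')} Nw≡comb (quotient-decomposition (suc k'))
      p≈w : p ≈ₚ w
      p≈w = proj₂ (proj₂ (proj₂ one-point)) p (r (suc k') , N , (>-nonZero⁻¹ N , σ≡N , Np≡comb) , λ j → r>0 j z<s k<N)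
      r₁≡d₁ : r (suc k') f1 ≡ d f1
      r₁≡d₁ = barycentric-unique₁ {v = v} {a = r (suc k')} {b = d} (proj₁ one-point)
        (λ c → trans (sym (Np≡comb c)) (trans (cong (ℤ.+ N ℤ.*_) (p≈w c)) (Nw≡comb c)))
        (trans σ≡N (sym Σd≡N))
      N∣k' : N ∣ k'
      N∣k' = N∣k*d⇒N∣k f1 (divides (suc k' * d f1 / N) (+-cancelˡ-≡ (d f1) (k' * d f1) _
        (trans (quotient-decomposition (suc k') f1) (cong (_+ suc k' * d f1 / N * N) r₁≡d₁))))
      multiple<N⇒≡0 : ∀ m → m < N → N ∣ m → m ≡ 0
      multiple<N⇒≡0 0 _ _ = refl
      multiple<N⇒≡0 (suc _) m<N N∣m = contradiction (∣⇒≤ N∣m) (<⇒≱ m<N)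

lemma10 : (v : Tetra) (w : Point) → OnePointWith v w →
    (d : Fin 4 → ℕ) (N : ℕ) →
    (∀ j → 0 < d j) → sum4 d ≡ N → (∀ j → gcd (d j) N ≡ 1) →
    scale N w ≈ₚ comb d v →
    ∀ i → ∃[ j ] ∃[ k ] (j ≢ i × k ≢ i × j ≢ k × d i ∣ d j + d k)
lemma10 v w one-point d N d>0 Σd≡N gcd≡1 Nw≡comb = complementary-pair-divisible (σ≡N⇒k≡1 one-point N d d>0 Σd≡N d⊥N Nw≡comb)
  where
    instance
      _ : NonZero N
      _ = >-nonZero (<-≤-trans (d>0 f0) (≤-trans (≤sum4 d f0) (≤-reflexive Σd≡N)))
    d⊥N : ∀ j → Coprime (d j) N
    d⊥N j = gcd≡1⇒coprime (gcd≡1 j)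
    open Residues N d d>0 Σd≡N d⊥N
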